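{- Let $G=(V,E)$ be a directed graph with non-negative edge weights $w$, with source $s\in V$, let $\xi\in(0,1)$, let $k\ge 0$ be an integer, and let $d:V\to\mathbb{R}_{\ge0}$ be estimates satisfying $d(v)\leq (1+\xi)(d(u)+w(e))$ for every edge $uv=e\in E$. Let $U\subseteq V$ be a set of vertices that are $k$-certified. After running $V_{\mathrm{touched}}:=\mathrm{Propagate}(V\setminus U)$, every vertex of $V_{\mathrm{touched}}$ is $(k+1)$-certified (with respect to the estimates after the procedure).
   Context: A vertex $u\in V$ is $k$-certified (with respect to the current estimates $d$) if for every path $P=u\to v$ in the induced subgraph $G[V\setminus\{s\}]$ we have $d(v)\leq (1+\xi)^k(d(u)+w(P))$, where $w(P)$ is the sum of edge weights of $P$ (paths need not be simple). The procedure $\mathrm{Propagate}(V_{\mathrm{input}})$ modifies $d$ in place: initialize a min-priority queue $Q$ containing $V_{\mathrm{input}}$, keyed by $d(\cdot)$, and a set $V_{\mathrm{touched}}:=V_{\mathrm{input}}$. While $Q\neq\emptyset$: pop $u$ with minimum key; for every edge $uv=e\in E$: if $v\in Q$, set $d(v):=\min(d(v),d(u)+w(e))$; otherwise, if $d(v)>(1+\xi)(d(u)+w(e))$, set $d(v):=d(u)+w(e)$ and insert $v$ into $Q$ and $V_{\mathrm{touched}}$. Return $V_{\mathrm{touched}}$.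
   Formalization: The estimates d, the edge weights w and the parameter ξ take rational values instead of real ones. -}

module Defs where

open import Data.Nat using (ℕ; zero; suc)
open import Data.Fin using (Fin; _≟_)
open import Data.Fin.Subset using (Subset; _∈_; _∉_; _∪_; _-_; ⁅_⁆; ∁)
open import Data.Rational using (ℚ; 0ℚ; 1ℚ; _+_; _*_; _≤_; _<_; _⊓_)
open import Data.List using (List; []; _∷_; filter)
open import Data.List.Relation.Binary.Permutation.Propositional using (_↭_)
open import Data.List.Membership.Propositional using () renaming (_∈_ to _∈ₗ_)
open import Data.Bool using (if_then_else_)
open import Data.Product using (_×_)
open import Relation.Nullary using (¬_; does)
open import Relation.Binary.PropositionalEquality using (_≡_; _≢_)
open import Relation.Binary.Construct.Closure.ReflexiveTransitive using (Star)

_^ℚ_ : ℚ → ℕ → ℚ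
q ^ℚ zero  = 1ℚ
q ^ℚ suc k = q * (q ^ℚ k)

-- weighted directed edge on vertex set Fin n (multigraphs allowed: E is a list)
record Edge (n : ℕ) : Set where
  constructor edge
  field
    src : Fin n
    tgt : Fin n
    wt  : ℚ
open Edge public

-- Walks (not necessarily simple) in the induced subgraph G[V ∖ {s}],
-- indexed by start, end and total weight.  Every vertex on the walk is ≠ s.
data Walk {n : ℕ} (E : List (Edge n)) (s : Fin n) : Fin n → Fin n → ℚ → Set where
  nil  : ∀ {u} → u ≢ s → Walk E s u u 0ℚ
  cons : ∀ {u v w} (e : Edge n) → e ∈ₗ E → src e ≡ u → u ≢ s →
         Walk E s (tgt e) v w → Walk E s u v (wt e + w)

onePlus : ℚ → ℚ
onePlus ξ = 1ℚ + ξ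

Certified : ∀ {n} → List (Edge n) → Fin n → ℚ → ℕ → (Fin n → ℚ) → Fin n → Set
Certified E s ξ k d u =
  ∀ v w → Walk E s u v w → d v ≤ (onePlus ξ ^ℚ k) * (d u + w)

upd : ∀ {n} → (Fin n → ℚ) → Fin n → ℚ → (Fin n → ℚ)
upd d v x y = if does (y ≟ v) then x else d y

-- state of Propagate: estimates, queue Q, touched set, pending edges of the
-- currently popped vertex (processed one at a time)
record PState (n : ℕ) : Set where
  constructor ⟨_,_,_,_⟩
  field
    est     : Fin n → ℚ
    queue   : Subset n
    touched : Subset n
    pending : List (Edge n)
open PState public

outEdges : ∀ {n} → List (Edge n) → Fin n → List (Edge n)
outEdges E u = filter (λ e → src e ≟ u) E

-- one step of Propagate (nondeterministic: ties in the min-priority queue and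
-- the order in which out-edges are scanned are arbitrary)
data Step {n : ℕ} (E : List (Edge n)) (ξ : ℚ) : PState n → PState n → Set where
  pop : ∀ {d Q T u es} → u ∈ Q → (∀ x → x ∈ Q → d u ≤ d x) →
        es ↭ outEdges E u →
        Step E ξ ⟨ d , Q , T , [] ⟩ ⟨ d , Q - u , T , es ⟩
  inQ : ∀ {d Q T e es} → tgt e ∈ Q →
        Step E ξ ⟨ d , Q , T , e ∷ es ⟩
                 ⟨ upd d (tgt e) (d (tgt e) ⊓ (d (src e) + wt e)) , Q , T , es ⟩
  relax : ∀ {d Q T e es} → tgt e ∉ Q →
        onePlus ξ * (d (src e) + wt e) < d (tgt e) →
        Step E ξ ⟨ d , Q , T , e ∷ es ⟩
                 ⟨ upd d (tgt e) (d (src e) + wt e) , Q ∪ ⁅ tgt e ⁆ , T ∪ ⁅ tgt e ⁆ , es ⟩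
  skip : ∀ {d Q T e es} → tgt e ∉ Q →
        ¬ (onePlus ξ * (d (src e) + wt e) < d (tgt e)) →
        Step E ξ ⟨ d , Q , T , e ∷ es ⟩ ⟨ d , Q , T , es ⟩

-- Propagate(V_input) started from estimates d terminates in final state st
-- (queue empty, no pending edges); returns touched st, final estimates est st.
PropagateRun : ∀ {n} → List (Edge n) → ℚ → (Fin n → ℚ) → Subset n → PState n → Set
PropagateRun {n} E ξ d Vin st =
  Star (Step E ξ) ⟨ d , Vin , Vin , [] ⟩ st
  × (∀ (x : Fin n) → x ∉ queue st) × pending st ≡ []

{-# OPTIONS --safe #-}
-- Propagate is Dijkstra's algorithm that skips relaxations gaining less than a factor 1 + ξ.
-- As in Dijkstra, popped keys never decrease, so a settled vertex (touched, no longer queued)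
-- is never improved again; estimates only decrease, and untouched vertices lie in U and keep
-- their old estimate d₀.  Hence at termination every edge u → y out of a touched vertex is
-- relaxed: either d(y) ≤ d(u) + w, or y is a vertex of U with d₀(y) ≤ (1 + ξ)(d(u) + w).
-- Along a walk from a touched vertex, edges of the first kind keep the bound d(u) + w(P)
-- exact while the walk stays among touched vertices; once it leaves them, or crosses an edge
-- of the second kind, it is at a vertex of U, whose k-certificate for d₀ ≥ d takes over.
module Submission where

open import Defs
open import Data.Nat using (ℕ; zero; suc)
open import Data.Fin using (Fin) renaming (_≟_ to _≟ᶠ_)
open import Data.Fin.Subset using (Subset; _∈_; _∉_; _⊆_; _∪_; _─_; _-_; ⁅_⁆; ∁; outside)
open import Data.Fin.Subset.Properties
  using (x∈p∪q⁻; x∈p∪q⁺; x∈⁅x⁆; x∈⁅y⁆⇒x≡y; x∈p∧x≢y⇒x∈p-y; x∉∁p⇒x∈p; p─q⊆p; _∈?_)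
open import Data.Rational using (ℚ; 0ℚ; 1ℚ; _+_; _*_; _≤_; _<_; _⊓_; nonNegative)
open import Data.Rational.Properties
  using ( ≤-refl; ≤-reflexive; ≤-trans; <⇒≤; <-≤-trans; <-irrefl; ≮⇒≥; +-mono-≤; +-monoˡ-≤
        ; +-monoʳ-≤; *-monoʳ-≤-nonNeg; *-monoˡ-≤-nonNeg; +-identityʳ; *-identityˡ; *-zeroʳ
        ; +-assoc; *-assoc; *-comm; *-distribˡ-+; nonNegative⁻¹; p⊓q≤p; p⊓q≤q; ⊓-glb
        ; module ≤-Reasoning )
open import Data.List using (List; []; _∷_)
import Data.Vec.Base as Vec
open import Data.List.Relation.Unary.Any using (here; there)
open import Data.List.Membership.Propositional using () renaming (_∈_ to _∈ₗ_)
open import Data.List.Membership.Propositional.Properties using (∈-filter⁻; ∈-filter⁺)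
open import Data.List.Relation.Binary.Permutation.Propositional using (_↭_; ↭-sym)
open import Data.List.Relation.Binary.Permutation.Propositional.Properties using (∈-resp-↭)
open import Data.Product using (_×_; _,_; proj₁; proj₂)
open import Data.Sum using (_⊎_; inj₁; inj₂)
open import Function using (id)
open import Relation.Nullary using (¬_; yes; no; contradiction)
open import Relation.Binary.PropositionalEquality
  using (_≡_; _≢_; refl; sym; trans; cong; subst)
open import Relation.Binary.Construct.Closure.ReflexiveTransitive using (Star; ε; _◅_)

x∈p─q⇒x∉q : ∀ {n} {x : Fin n} (p q : Subset n) → x ∈ p ─ q → x ∉ q
x∈p─q⇒x∉q (_ Vec.∷ _) (outside Vec.∷ _) Vec.here ()
x∈p─q⇒x∉q (_ Vec.∷ p) (_ Vec.∷ q) (Vec.there x∈p─q) (Vec.there x∈q) = x∈p─q⇒x∉q p q x∈p─q x∈q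

x∉p-x : ∀ {n} (p : Subset n) (x : Fin n) → x ∉ p - x
x∉p-x p x x∈p-x = x∈p─q⇒x∉q p ⁅ x ⁆ x∈p-x (x∈⁅x⁆ x)

∪-monoˡ-⊆ : ∀ {n} {p q : Subset n} (r : Subset n) → p ⊆ q → p ∪ r ⊆ q ∪ r
∪-monoˡ-⊆ {p = p} r p⊆q x∈p∪r with x∈p∪q⁻ p r x∈p∪r
... | inj₁ x∈p = x∈p∪q⁺ (inj₁ (p⊆q x∈p))
... | inj₂ x∈r = x∈p∪q⁺ (inj₂ x∈r)

x∉p∪⁅y⁆⇒x∉p∧x≢y : ∀ {n} {x y : Fin n} (p : Subset n) → x ∉ p ∪ ⁅ y ⁆ → x ∉ p × x ≢ y
x∉p∪⁅y⁆⇒x∉p∧x≢y {y = y} p x∉p∪y =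
  (λ x∈p → x∉p∪y (x∈p∪q⁺ (inj₁ x∈p))) , (λ { refl → x∉p∪y (x∈p∪q⁺ (inj₂ (x∈⁅x⁆ y))) })

x∈p∪⁅y⁆∧x≢y⇒x∈p : ∀ {n} {x y : Fin n} (p : Subset n) → x ∈ p ∪ ⁅ y ⁆ → x ≢ y → x ∈ p
x∈p∪⁅y⁆∧x≢y⇒x∈p {y = y} p x∈p∪y x≢y with x∈p∪q⁻ p ⁅ y ⁆ x∈p∪y
... | inj₁ x∈p = x∈p
... | inj₂ x∈y = contradiction (x∈⁅y⁆⇒x≡y y x∈y) x≢y

x∈p∪r∧x∉q∪r⇒x∈p∧x∉q : ∀ {n} {x : Fin n} (p q r : Subset n) →
                      x ∈ p ∪ r → x ∉ q ∪ r → x ∈ p × x ∉ q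
x∈p∪r∧x∉q∪r⇒x∈p∧x∉q p q r x∈p∪r x∉q∪r with x∈p∪q⁻ p r x∈p∪r
... | inj₁ x∈p = x∈p , λ x∈q → x∉q∪r (x∈p∪q⁺ (inj₁ x∈q))
... | inj₂ x∈r = contradiction (x∈p∪q⁺ (inj₂ x∈r)) x∉q∪r

upd-updates : ∀ {n} (d : Fin n → ℚ) (v : Fin n) (x : ℚ) → upd d v x v ≡ x
upd-updates d v x with v ≟ᶠ v
... | yes _   = refl
... | no v≢v = contradiction refl v≢v

upd-minimal : ∀ {n} (d : Fin n → ℚ) {v y : Fin n} (x : ℚ) → y ≢ v → upd d v x y ≡ d y
upd-minimal d {v} {y} x y≢v with y ≟ᶠ v
... | yes y≡v = contradiction y≡v y≢v
... | no _    = refl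

upd-elim : ∀ {n} (P : Fin n → ℚ → Set) {d : Fin n → ℚ} {v : Fin n} {x : ℚ} →
           P v x → (∀ y → y ≢ v → P y (d y)) → ∀ y → P y (upd d v x y)
upd-elim P {v = v} Pvx Pd y with y ≟ᶠ v
... | yes refl = Pvx
... | no y≢v   = Pd y y≢v

upd-≤ : ∀ {n} {d : Fin n → ℚ} {v : Fin n} {x : ℚ} → x ≤ d v → ∀ y → upd d v x y ≤ d y
upd-≤ {d = d} x≤dv = upd-elim (λ y z → z ≤ d y) x≤dv (λ _ _ → ≤-refl)

p≤p+q : ∀ p {q} → 0ℚ ≤ q → p ≤ p + q
p≤p+q p 0≤q = ≤-trans (≤-reflexive (sym (+-identityʳ p))) (+-monoʳ-≤ p 0≤q)

+-pres-0≤ : ∀ {p q} → 0ℚ ≤ p → 0ℚ ≤ q → 0ℚ ≤ p + q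
+-pres-0≤ {p} 0≤p 0≤q = ≤-trans 0≤p (p≤p+q p 0≤q)

*-monoˡ-≤-0≤ : ∀ {r p q} → 0ℚ ≤ r → p ≤ q → r * p ≤ r * q
*-monoˡ-≤-0≤ {r} 0≤r = *-monoˡ-≤-nonNeg r {{nonNegative 0≤r}}

*-pres-0≤ : ∀ {p q} → 0ℚ ≤ p → 0ℚ ≤ q → 0ℚ ≤ p * q
*-pres-0≤ {p} 0≤p 0≤q = ≤-trans (≤-reflexive (sym (*-zeroʳ p))) (*-monoˡ-≤-0≤ 0≤p 0≤q)

1≤onePlus : ∀ {ξ} → 0ℚ ≤ ξ → 1ℚ ≤ onePlus ξ
1≤onePlus 0≤ξ = p≤p+q 1ℚ 0≤ξ

module Powers (a : ℚ) (1≤a : 1ℚ ≤ a) where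

  0≤a : 0ℚ ≤ a
  0≤a = ≤-trans (nonNegative⁻¹ 1ℚ) 1≤a

  0≤a^k : ∀ k → 0ℚ ≤ a ^ℚ k
  0≤a^k zero    = nonNegative⁻¹ 1ℚ
  0≤a^k (suc k) = *-pres-0≤ 0≤a (0≤a^k k)

  p≤a*p : ∀ {p} → 0ℚ ≤ p → p ≤ a * p
  p≤a*p {p} 0≤p = ≤-trans (≤-reflexive (sym (*-identityˡ p)))
                          (*-monoʳ-≤-nonNeg p {{nonNegative 0≤p}} 1≤a)

  p≤a^k*p : ∀ k {p} → 0ℚ ≤ p → p ≤ a ^ℚ k * p
  p≤a^k*p zero    {p} 0≤p = ≤-reflexive (sym (*-identityˡ p))
  p≤a^k*p (suc k) {p} 0≤p = begin
    p                 ≤⟨ p≤a^k*p k 0≤p ⟩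
    a ^ℚ k * p        ≤⟨ p≤a*p (*-pres-0≤ (0≤a^k k) 0≤p) ⟩
    a * (a ^ℚ k * p)  ≡⟨ *-assoc a (a ^ℚ k) p ⟨
    a ^ℚ suc k * p    ∎
    where open ≤-Reasoning

  a^k*[a*p]≡a^suc-k*p : ∀ k p → a ^ℚ k * (a * p) ≡ a ^ℚ suc k * p
  a^k*[a*p]≡a^suc-k*p k p = trans (sym (*-assoc (a ^ℚ k) a p)) (cong (_* p) (*-comm (a ^ℚ k) a))

walk-weight≥0 : ∀ {n} {E : List (Edge n)} {s u v : Fin n} {w : ℚ} →
                (∀ e → e ∈ₗ E → 0ℚ ≤ wt e) → Walk E s u v w → 0ℚ ≤ w
walk-weight≥0 w≥0 (nil _)                = ≤-refl
walk-weight≥0 w≥0 (cons e e∈E _ _ walk) = +-pres-0≤ (w≥0 e e∈E) (walk-weight≥0 w≥0 walk)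

data Relaxed {n} (ξ : ℚ) (U : Subset n) (d₀ d : Fin n → ℚ) (e : Edge n) : Set where
  tight : d (tgt e) ≤ d (src e) + wt e → Relaxed ξ U d₀ d e
  slack : tgt e ∈ U → d₀ (tgt e) ≤ onePlus ξ * (d (src e) + wt e) → Relaxed ξ U d₀ d e

module Certification {n : ℕ} (E : List (Edge n)) (s : Fin n) (ξ : ℚ) (0≤ξ : 0ℚ ≤ ξ)
  (w≥0 : ∀ e → e ∈ₗ E → 0ℚ ≤ wt e) (k : ℕ) (U : Subset n) (d₀ : Fin n → ℚ)
  (U-certified : ∀ u → u ∈ U → Certified E s ξ k d₀ u)
  (T : Subset n) (d : Fin n → ℚ) (d≥0 : ∀ x → 0ℚ ≤ d x) (d≤d₀ : ∀ x → d x ≤ d₀ x)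
  (d≡d₀-outside : ∀ x → x ∉ T → d x ≡ d₀ x) (outside⊆U : ∀ x → x ∉ T → x ∈ U)
  (T-relaxed : ∀ e → e ∈ₗ E → src e ∈ T → Relaxed ξ U d₀ d e) where

  open Powers (onePlus ξ) (1≤onePlus 0≤ξ)
  open ≤-Reasoning

  a : ℚ
  a = onePlus ξ

  relaxed-cases : ∀ e → e ∈ₗ E → src e ∈ T →
                  (tgt e ∈ T × d (tgt e) ≤ d (src e) + wt e)
                  ⊎ (tgt e ∈ U × d₀ (tgt e) ≤ a * (d (src e) + wt e))
  relaxed-cases e e∈E u∈T with T-relaxed e e∈E u∈T | tgt e ∈? T
  ... | tight dy≤X | yes y∈T = inj₁ (y∈T , dy≤X)
  ... | tight dy≤X | no y∉T  = inj₂ (outside⊆U _ y∉T , d₀y≤aX)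
    where
    d₀y≤aX : d₀ (tgt e) ≤ a * (d (src e) + wt e)
    d₀y≤aX = begin
      d₀ (tgt e)             ≡⟨ d≡d₀-outside _ y∉T ⟨
      d (tgt e)              ≤⟨ dy≤X ⟩
      d (src e) + wt e       ≤⟨ p≤a*p (+-pres-0≤ (d≥0 (src e)) (w≥0 e e∈E)) ⟩
      a * (d (src e) + wt e) ∎
  ... | slack y∈U d₀y≤aX | _ = inj₂ (y∈U , d₀y≤aX)

  -- The single extra factor (1 + ξ) is spent here, on the edge entering U.
  entering-U : ∀ {y v X W} → y ∈ U → d₀ y ≤ a * X → Walk E s y v W →
               d v ≤ a ^ℚ suc k * (X + W)
  entering-U {y} {v} {X} {W} y∈U d₀y≤aX walk = begin
    d v                      ≤⟨ d≤d₀ v ⟩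
    d₀ v                     ≤⟨ U-certified y y∈U v W walk ⟩
    a ^ℚ k * (d₀ y + W)      ≤⟨ *-monoˡ-≤-0≤ (0≤a^k k) (+-mono-≤ d₀y≤aX (p≤a*p 0≤W)) ⟩
    a ^ℚ k * (a * X + a * W) ≡⟨ cong (a ^ℚ k *_) (*-distribˡ-+ a X W) ⟨
    a ^ℚ k * (a * (X + W))   ≡⟨ a^k*[a*p]≡a^suc-k*p k (X + W) ⟩
    a ^ℚ suc k * (X + W)     ∎
    where
    0≤W : 0ℚ ≤ W
    0≤W = walk-weight≥0 w≥0 walk

  touched-certified : ∀ u → u ∈ T → Certified E s ξ (suc k) d u
  touched-certified u u∈T .u .0ℚ (nil _) = begin
    d u                     ≡⟨ +-identityʳ (d u) ⟨
    d u + 0ℚ                ≤⟨ p≤a^k*p (suc k) (+-pres-0≤ (d≥0 u) ≤-refl) ⟩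
    a ^ℚ suc k * (d u + 0ℚ) ∎
  touched-certified u u∈T v .(wt e + W) (cons {w = W} e e∈E refl _ walk) = begin
    d v                             ≤⟨ via-e (relaxed-cases e e∈E u∈T) ⟩
    a ^ℚ suc k * (d u + wt e + W)   ≡⟨ cong (a ^ℚ suc k *_) (+-assoc (d u) (wt e) W) ⟩
    a ^ℚ suc k * (d u + (wt e + W)) ∎
    where
    via-e : (tgt e ∈ T × d (tgt e) ≤ d u + wt e) ⊎ (tgt e ∈ U × d₀ (tgt e) ≤ a * (d u + wt e)) →
            d v ≤ a ^ℚ suc k * (d u + wt e + W)
    via-e (inj₁ (y∈T , dy≤X))   = ≤-trans (touched-certified (tgt e) y∈T v W walk)
                                          (*-monoˡ-≤-0≤ (0≤a^k (suc k)) (+-monoˡ-≤ W dy≤X))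
    via-e (inj₂ (y∈U , d₀y≤aX)) = entering-U y∈U d₀y≤aX walk

∈-outEdges⁻ : ∀ {n} {E : List (Edge n)} {u : Fin n} {e : Edge n} →
              e ∈ₗ outEdges E u → e ∈ₗ E × src e ≡ u
∈-outEdges⁻ {u = u} = ∈-filter⁻ (λ e → src e ≟ᶠ u)

∈-outEdges⁺ : ∀ {n} {E : List (Edge n)} {u : Fin n} {e : Edge n} →
              e ∈ₗ E → src e ≡ u → e ∈ₗ outEdges E u
∈-outEdges⁺ {u = u} = ∈-filter⁺ (λ e → src e ≟ᶠ u)

module PropagateInvariant {n : ℕ} (E : List (Edge n)) (ξ : ℚ) (0≤ξ : 0ℚ ≤ ξ)
  (w≥0 : ∀ e → e ∈ₗ E → 0ℚ ≤ wt e) (U : Subset n) (d₀ : Fin n → ℚ) (d₀≥0 : ∀ x → 0ℚ ≤ d₀ x) where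

  open Powers (onePlus ξ) (1≤onePlus 0≤ξ) using (p≤a*p)

  relaxed-anti : ∀ {d d′ : Fin n → ℚ} e → (∀ x → d′ x ≤ d x) → d′ (src e) ≡ d (src e) →
                 Relaxed ξ U d₀ d e → Relaxed ξ U d₀ d′ e
  relaxed-anti e d′≤d src-kept (tight dy≤X) =
    tight (≤-trans (d′≤d (tgt e)) (≤-trans dy≤X (≤-reflexive (cong (_+ wt e) (sym src-kept)))))
  relaxed-anti e d′≤d src-kept (slack y∈U d₀y≤aX) =
    slack y∈U (≤-trans d₀y≤aX
                       (≤-reflexive (cong (λ z → onePlus ξ * (z + wt e)) (sym src-kept))))

  retire-head : ∀ {d d′ : Fin n → ℚ} {e e′ : Edge n} {es : List (Edge n)} →
                Relaxed ξ U d₀ d′ e → (Relaxed ξ U d₀ d e′ → Relaxed ξ U d₀ d′ e′) →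
                Relaxed ξ U d₀ d e′ ⊎ e′ ∈ₗ e ∷ es → Relaxed ξ U d₀ d′ e′ ⊎ e′ ∈ₗ es
  retire-head e-relaxed keep (inj₁ e′-relaxed)    = inj₁ (keep e′-relaxed)
  retire-head e-relaxed keep (inj₂ (here refl))   = inj₁ e-relaxed
  retire-head e-relaxed keep (inj₂ (there e′∈es)) = inj₂ e′∈es

  -- `level` is the key of the last popped vertex.
  record Invariant (st : PState n) : Set where
    field
      level           : ℚ
      est≥0           : ∀ x → 0ℚ ≤ est st x
      est≤d₀          : ∀ x → est st x ≤ d₀ x
      untouched-est   : ∀ x → x ∉ touched st → est st x ≡ d₀ x
      untouched∈U     : ∀ x → x ∉ touched st → x ∈ U
      queue⊆touched   : queue st ⊆ touched st
      pending⊆E       : ∀ e → e ∈ₗ pending st → e ∈ₗ E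
      pending-touched : ∀ e → e ∈ₗ pending st → src e ∈ touched st
      pending-∉queue  : ∀ e → e ∈ₗ pending st → src e ∉ queue st
      pending-level   : ∀ e → e ∈ₗ pending st → est st (src e) ≡ level
      settled≤level   : ∀ x → x ∈ touched st → x ∉ queue st → est st x ≤ level
      level≤queued    : ∀ x → x ∈ queue st → level ≤ est st x
      settled-relaxed : ∀ e → e ∈ₗ E → src e ∈ touched st → src e ∉ queue st →
                        Relaxed ξ U d₀ (est st) e ⊎ e ∈ₗ pending st

  init : Invariant ⟨ d₀ , ∁ U , ∁ U , [] ⟩
  init = record
    { level           = 0ℚ
    ; est≥0           = d₀≥0
    ; est≤d₀          = λ _ → ≤-refl
    ; untouched-est   = λ _ _ → refl
    ; untouched∈U     = λ _ → x∉∁p⇒x∈p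
    ; queue⊆touched   = id
    ; pending⊆E       = λ _ ()
    ; pending-touched = λ _ ()
    ; pending-∉queue  = λ _ ()
    ; pending-level   = λ _ ()
    ; settled≤level   = λ _ x∈T x∉Q → contradiction x∈T x∉Q
    ; level≤queued    = λ x _ → d₀≥0 x
    ; settled-relaxed = λ _ _ x∈T x∉Q → contradiction x∈T x∉Q
    }

  pop-preserves : ∀ {d Q T u es} → u ∈ Q → (∀ x → x ∈ Q → d u ≤ d x) → es ↭ outEdges E u →
                  Invariant ⟨ d , Q , T , [] ⟩ → Invariant ⟨ d , Q - u , T , es ⟩
  pop-preserves {d} {Q} {T} {u} {es} u∈Q u-min es↭out I = record
    { level           = d u
    ; est≥0           = est≥0
    ; est≤d₀          = est≤d₀
    ; untouched-est   = untouched-est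
    ; untouched∈U     = untouched∈U
    ; queue⊆touched   = λ x∈Q-u → queue⊆touched (p─q⊆p Q ⁅ u ⁆ x∈Q-u)
    ; pending⊆E       = λ e e∈es → proj₁ (out e∈es)
    ; pending-touched = λ e e∈es → subst (_∈ T) (sym (proj₂ (out e∈es))) (queue⊆touched u∈Q)
    ; pending-∉queue  = λ e e∈es → subst (_∉ Q - u) (sym (proj₂ (out e∈es))) (x∉p-x Q u)
    ; pending-level   = λ e e∈es → cong d (proj₂ (out e∈es))
    ; settled≤level   = settled≤du
    ; level≤queued    = λ x x∈Q-u → u-min x (p─q⊆p Q ⁅ u ⁆ x∈Q-u)
    ; settled-relaxed = settled-relaxed′
    }
    where
    open Invariant I

    out : ∀ {e} → e ∈ₗ es → e ∈ₗ E × src e ≡ u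
    out e∈es = ∈-outEdges⁻ (∈-resp-↭ es↭out e∈es)

    ∉Q : ∀ {x} → x ∉ Q - u → x ≢ u → x ∉ Q
    ∉Q x∉Q-u x≢u x∈Q = x∉Q-u (x∈p∧x≢y⇒x∈p-y x∈Q x≢u)

    settled≤du : ∀ x → x ∈ T → x ∉ Q - u → d x ≤ d u
    settled≤du x x∈T x∉Q-u with x ≟ᶠ u
    ... | yes refl = ≤-refl
    ... | no x≢u   = ≤-trans (settled≤level x x∈T (∉Q x∉Q-u x≢u)) (level≤queued u u∈Q)

    settled-relaxed′ : ∀ e → e ∈ₗ E → src e ∈ T → src e ∉ Q - u →
                       Relaxed ξ U d₀ d e ⊎ e ∈ₗ es
    settled-relaxed′ e e∈E x∈T x∉Q-u with src e ≟ᶠ u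
    ... | yes x≡u = inj₂ (∈-resp-↭ (↭-sym es↭out) (∈-outEdges⁺ e∈E x≡u))
    ... | no x≢u with settled-relaxed e e∈E x∈T (∉Q x∉Q-u x≢u)
    ...   | inj₁ relaxed = inj₁ relaxed
    ...   | inj₂ ()

  level≤head : ∀ {d Q T e es} → (I : Invariant ⟨ d , Q , T , e ∷ es ⟩) →
               Invariant.level I ≤ d (src e) + wt e
  level≤head {d} {e = e} I = ≤-trans (≤-reflexive (sym (pending-level e (here refl))))
                                      (p≤p+q (d (src e)) (w≥0 e (pending⊆E e (here refl))))
    where open Invariant I

  0≤head : ∀ {d Q T e es} → Invariant ⟨ d , Q , T , e ∷ es ⟩ → 0ℚ ≤ d (src e) + wt e
  0≤head {e = e} I = +-pres-0≤ (est≥0 (src e)) (w≥0 e (pending⊆E e (here refl)))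
    where open Invariant I

  relaxed-target∉touched : ∀ {d Q T e es} (I : Invariant ⟨ d , Q , T , e ∷ es ⟩) → tgt e ∉ Q →
                           onePlus ξ * (d (src e) + wt e) < d (tgt e) → tgt e ∉ T
  relaxed-target∉touched {d} {e = e} I y∉Q improves y∈T =
    <-irrefl refl (<-≤-trans improves (begin
      d (tgt e)                      ≤⟨ settled≤level (tgt e) y∈T y∉Q ⟩
      level                          ≤⟨ level≤head I ⟩
      d (src e) + wt e               ≤⟨ p≤a*p (0≤head I) ⟩
      onePlus ξ * (d (src e) + wt e) ∎))
    where
    open Invariant I
    open ≤-Reasoning

  inQueue-preserves : ∀ {d Q T e es} → tgt e ∈ Q → Invariant ⟨ d , Q , T , e ∷ es ⟩ →
                      Invariant ⟨ upd d (tgt e) (d (tgt e) ⊓ (d (src e) + wt e)) , Q , T , es ⟩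
  inQueue-preserves {d} {Q} {e = e} y∈Q I = record
    { level           = level
    ; est≥0           = upd-elim (λ _ z → 0ℚ ≤ z) (⊓-glb (est≥0 y) (0≤head I)) (λ x _ → est≥0 x)
    ; est≤d₀          = λ x → ≤-trans (d′≤d x) (est≤d₀ x)
    ; untouched-est   = λ x x∉T →
        trans (unchanged (≢y (λ x∈Q → x∉T (queue⊆touched x∈Q)))) (untouched-est x x∉T)
    ; untouched∈U     = untouched∈U
    ; queue⊆touched   = queue⊆touched
    ; pending⊆E       = λ e′ e′∈es → pending⊆E e′ (there e′∈es)
    ; pending-touched = λ e′ e′∈es → pending-touched e′ (there e′∈es)
    ; pending-∉queue  = λ e′ e′∈es → pending-∉queue e′ (there e′∈es)
    ; pending-level   = λ e′ e′∈es →
        trans (unchanged (≢y (pending-∉queue e′ (there e′∈es)))) (pending-level e′ (there e′∈es))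
    ; settled≤level   = λ x x∈T x∉Q →
        ≤-trans (≤-reflexive (unchanged (≢y x∉Q))) (settled≤level x x∈T x∉Q)
    ; level≤queued    = upd-elim (λ x z → x ∈ Q → level ≤ z)
                                 (λ _ → ⊓-glb (level≤queued y y∈Q) (level≤head I))
                                 (λ x _ → level≤queued x)
    ; settled-relaxed = λ e′ e′∈E x∈T x∉Q →
        retire-head e-relaxed (relaxed-anti e′ d′≤d (unchanged (≢y x∉Q)))
                    (settled-relaxed e′ e′∈E x∈T x∉Q)
    }
    where
    open Invariant I
    open ≤-Reasoning

    y u : Fin n
    y = tgt e
    u = src e

    d′ : Fin n → ℚ
    d′ = upd d y (d y ⊓ (d u + wt e))

    ≢y : ∀ {x} → x ∉ Q → x ≢ y
    ≢y x∉Q refl = x∉Q y∈Q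

    unchanged : ∀ {x} → x ≢ y → d′ x ≡ d x
    unchanged = upd-minimal d _

    d′≤d : ∀ x → d′ x ≤ d x
    d′≤d = upd-≤ (p⊓q≤p (d y) (d u + wt e))

    e-relaxed : Relaxed ξ U d₀ d′ e
    e-relaxed = tight (begin
      d′ y              ≡⟨ upd-updates d y _ ⟩
      d y ⊓ (d u + wt e) ≤⟨ p⊓q≤q (d y) (d u + wt e) ⟩
      d u + wt e        ≡⟨ cong (_+ wt e) (unchanged (≢y (pending-∉queue e (here refl)))) ⟨
      d′ u + wt e       ∎)

  relax-preserves : ∀ {d Q T e es} → tgt e ∉ Q → onePlus ξ * (d (src e) + wt e) < d (tgt e) →
                    Invariant ⟨ d , Q , T , e ∷ es ⟩ →
                    Invariant ⟨ upd d (tgt e) (d (src e) + wt e)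
                              , Q ∪ ⁅ tgt e ⁆ , T ∪ ⁅ tgt e ⁆ , es ⟩
  relax-preserves {d} {Q} {T} {e} {es} y∉Q improves I = record
    { level           = level
    ; est≥0           = upd-elim (λ _ z → 0ℚ ≤ z) (0≤head I) (λ x _ → est≥0 x)
    ; est≤d₀          = upd-elim (λ x z → z ≤ d₀ x) (≤-trans du+w≤dy (est≤d₀ y)) (λ x _ → est≤d₀ x)
    ; untouched-est   = λ x x∉T∪y →
        trans (unchanged (proj₂ (∉T∪y x∉T∪y))) (untouched-est x (proj₁ (∉T∪y x∉T∪y)))
    ; untouched∈U     = λ x x∉T∪y → untouched∈U x (proj₁ (∉T∪y x∉T∪y))
    ; queue⊆touched   = ∪-monoˡ-⊆ ⁅ y ⁆ queue⊆touched
    ; pending⊆E       = λ e′ e′∈es → pending⊆E e′ (there e′∈es)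
    ; pending-touched = λ e′ e′∈es → x∈p∪q⁺ (inj₁ (pending-touched e′ (there e′∈es)))
    ; pending-∉queue  = λ e′ e′∈es →
        still-settled (pending-touched e′ (there e′∈es)) (pending-∉queue e′ (there e′∈es))
    ; pending-level   = λ e′ e′∈es →
        trans (unchanged (T≢y (pending-touched e′ (there e′∈es)))) (pending-level e′ (there e′∈es))
    ; settled≤level   = settled≤level′
    ; level≤queued    = upd-elim (λ x z → x ∈ Q ∪ ⁅ y ⁆ → level ≤ z)
                                 (λ _ → level≤head I)
                                 (λ x x≢y x∈Q∪y → level≤queued x (x∈p∪⁅y⁆∧x≢y⇒x∈p Q x∈Q∪y x≢y))
    ; settled-relaxed = settled-relaxed′
    }
    where
    open Invariant I
    open ≤-Reasoning

    y u : Fin n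
    y = tgt e
    u = src e

    d′ : Fin n → ℚ
    d′ = upd d y (d u + wt e)

    du+w≤dy : d u + wt e ≤ d y
    du+w≤dy = ≤-trans (p≤a*p (0≤head I)) (<⇒≤ improves)

    T≢y : ∀ {x} → x ∈ T → x ≢ y
    T≢y x∈T refl = relaxed-target∉touched I y∉Q improves x∈T

    ∉T∪y : ∀ {x} → x ∉ T ∪ ⁅ y ⁆ → x ∉ T × x ≢ y
    ∉T∪y = x∉p∪⁅y⁆⇒x∉p∧x≢y T

    still-settled : ∀ {x} → x ∈ T → x ∉ Q → x ∉ Q ∪ ⁅ y ⁆
    still-settled x∈T x∉Q x∈Q∪y = x∉Q (x∈p∪⁅y⁆∧x≢y⇒x∈p Q x∈Q∪y (T≢y x∈T))

    unchanged : ∀ {x} → x ≢ y → d′ x ≡ d x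
    unchanged = upd-minimal d _

    d′≤d : ∀ x → d′ x ≤ d x
    d′≤d = upd-≤ du+w≤dy

    settled≤level′ : ∀ x → x ∈ T ∪ ⁅ y ⁆ → x ∉ Q ∪ ⁅ y ⁆ → d′ x ≤ level
    settled≤level′ x x∈T∪y x∉Q∪y with x∈p∪r∧x∉q∪r⇒x∈p∧x∉q T Q ⁅ y ⁆ x∈T∪y x∉Q∪y
    ... | x∈T , x∉Q = ≤-trans (≤-reflexive (unchanged (T≢y x∈T))) (settled≤level x x∈T x∉Q)

    e-relaxed : Relaxed ξ U d₀ d′ e
    e-relaxed = tight (≤-reflexive (begin-equality
      d′ y        ≡⟨ upd-updates d y _ ⟩
      d u + wt e  ≡⟨ cong (_+ wt e) (unchanged (T≢y (pending-touched e (here refl)))) ⟨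
      d′ u + wt e ∎))

    settled-relaxed′ : ∀ e′ → e′ ∈ₗ E → src e′ ∈ T ∪ ⁅ y ⁆ → src e′ ∉ Q ∪ ⁅ y ⁆ →
                       Relaxed ξ U d₀ d′ e′ ⊎ e′ ∈ₗ es
    settled-relaxed′ e′ e′∈E x∈T∪y x∉Q∪y with x∈p∪r∧x∉q∪r⇒x∈p∧x∉q T Q ⁅ y ⁆ x∈T∪y x∉Q∪y
    ... | x∈T , x∉Q = retire-head e-relaxed (relaxed-anti e′ d′≤d (unchanged (T≢y x∈T)))
                                  (settled-relaxed e′ e′∈E x∈T x∉Q)

  skip-preserves : ∀ {d Q T e es} → tgt e ∉ Q → ¬ (onePlus ξ * (d (src e) + wt e) < d (tgt e)) →
                   Invariant ⟨ d , Q , T , e ∷ es ⟩ → Invariant ⟨ d , Q , T , es ⟩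
  skip-preserves {d} {T = T} {e} y∉Q no-improvement I = record
    { level           = level
    ; est≥0           = est≥0
    ; est≤d₀          = est≤d₀
    ; untouched-est   = untouched-est
    ; untouched∈U     = untouched∈U
    ; queue⊆touched   = queue⊆touched
    ; pending⊆E       = λ e′ e′∈es → pending⊆E e′ (there e′∈es)
    ; pending-touched = λ e′ e′∈es → pending-touched e′ (there e′∈es)
    ; pending-∉queue  = λ e′ e′∈es → pending-∉queue e′ (there e′∈es)
    ; pending-level   = λ e′ e′∈es → pending-level e′ (there e′∈es)
    ; settled≤level   = settled≤level
    ; level≤queued    = level≤queued
    ; settled-relaxed = λ e′ e′∈E x∈T x∉Q →
        retire-head e-relaxed id (settled-relaxed e′ e′∈E x∈T x∉Q)
    }
    where
    open Invariant I

    e-relaxed : Relaxed ξ U d₀ d e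
    e-relaxed with tgt e ∈? T
    ... | yes y∈T = tight (≤-trans (settled≤level (tgt e) y∈T y∉Q) (level≤head I))
    ... | no y∉T  = slack (untouched∈U (tgt e) y∉T)
                          (≤-trans (≤-reflexive (sym (untouched-est (tgt e) y∉T)))
                                   (≮⇒≥ no-improvement))

  step-preserves : ∀ {st st′} → Step E ξ st st′ → Invariant st → Invariant st′
  step-preserves (pop u∈Q u-min es↭out) = pop-preserves u∈Q u-min es↭out
  step-preserves (inQ y∈Q)               = inQueue-preserves y∈Q
  step-preserves (relax y∉Q improves)    = relax-preserves y∉Q improves
  step-preserves (skip y∉Q no-improvement) = skip-preserves y∉Q no-improvement

  run-preserves : ∀ {st st′} → Star (Step E ξ) st st′ → Invariant st → Invariant st′
  run-preserves ε          I = I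
  run-preserves (step ◅ steps) I = run-preserves steps (step-preserves step I)

  terminal-relaxed : ∀ {st} → Invariant st → (∀ x → x ∉ queue st) → pending st ≡ [] →
                     ∀ e → e ∈ₗ E → src e ∈ touched st → Relaxed ξ U d₀ (est st) e
  terminal-relaxed I queue-empty no-pending e e∈E x∈T
    with Invariant.settled-relaxed I e e∈E x∈T (queue-empty (src e))
  ... | inj₁ e-relaxed   = e-relaxed
  ... | inj₂ e∈pending = contradiction (subst (e ∈ₗ_) no-pending e∈pending) λ ()

lemma3 : ∀ {n : ℕ} (E : List (Edge n)) (s : Fin n) (ξ : ℚ) (k : ℕ) (d : Fin n → ℚ) (U : Subset n)
    → (∀ e → e ∈ₗ E → 0ℚ ≤ wt e)
    → 0ℚ < ξ → ξ < 1ℚ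
    → (∀ v → 0ℚ ≤ d v)
    → (∀ e → e ∈ₗ E → d (tgt e) ≤ onePlus ξ * (d (src e) + wt e))
    → (∀ u → u ∈ U → Certified E s ξ k d u)
    → (st : PState n) → PropagateRun E ξ d (∁ U) st
    → ∀ v → v ∈ touched st → Certified E s ξ (suc k) (est st) v
lemma3 E s ξ k d U w≥0 0<ξ _ d≥0 _ U-certified st (run , queue-empty , no-pending) =
  touched-certified
  where
  open PropagateInvariant E ξ (<⇒≤ 0<ξ) w≥0 U d d≥0

  I : Invariant st
  I = run-preserves run init

  open Invariant I
  open Certification E s ξ (<⇒≤ 0<ξ) w≥0 k U d U-certified (touched st) (est st)
         est≥0 est≤d₀ untouched-est untouched∈U (terminal-relaxed I queue-empty no-pending)
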